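{- Let $k\in\mathbb{R}$, $k>0$, let $M=\begin{pmatrix} k-1 & k-1 & k\\ 1&0&0\\ 0&1&0\end{pmatrix}$ and $N_0=\begin{pmatrix} k-1 & 2k & 2k\\ 2 & 1-k & 2\\ \frac{2}{k} & \frac{2}{k} & -\frac{1}{k}(k^2+k-2)\end{pmatrix}$. For every integer $n\geq 1$, $$N_0M^{n}=\begin{pmatrix} j_{n+1}^{(3)}(k) & t_{n-1}^{(3)}(k) & kj_{n}^{(3)}(k) \\ j_{n}^{(3)}(k) & t_{n-2}^{(3)}(k) & kj_{n-1}^{(3)}(k)\\ j_{n-1}^{(3)}(k) & t_{n-3}^{(3)}(k) & kj_{n-2}^{(3)}(k) \end{pmatrix},$$ where $t_{m}^{(3)}(k)=(k-1)j_{m+1}^{(3)}(k)+kj_{m}^{(3)}(k)$ for every integer $m$.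
   Context: For $k>0$, the third-order $k$-Jacobsthal--Lucas sequence $(j_n^{(3)}(k))$ is defined by $j_0^{(3)}(k)=2$, $j_1^{(3)}(k)=k-1$, $j_2^{(3)}(k)=k^2+1$ and $j_{n+3}^{(3)}(k)=(k-1)j_{n+2}^{(3)}(k)+(k-1)j_{n+1}^{(3)}(k)+kj_{n}^{(3)}(k)$. It is extended to all negative integer indices by requiring the same recurrence to hold for all integers $n$, i.e. $j_{ -n}^{(3)}(k)=\frac{1-k}{k}j_{ -(n-1)}^{(3)}(k)+\frac{1-k}{k}j_{ -(n-2)}^{(3)}(k)+\frac{1}{k}j_{ -(n-3)}^{(3)}(k)$ for $n\geq1$. -}

module Defs where

open import Level using (Level)
open import Data.Nat using (ℕ; zero; suc)
open import Data.Fin using (Fin; zero; suc)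
open import Data.Integer using (ℤ; +_; -[1+_])
import Data.Integer as ℤ
open import Algebra.Bundles using (CommutativeRing)

-- Everything is parametrised by a commutative ring R and an element k of R
-- together with a chosen inverse kinv (k * kinv ≈ 1 is a hypothesis of the theorem).
module JL {c ℓ : Level} (R : CommutativeRing c ℓ) (k kinv : CommutativeRing.Carrier R) where
  open CommutativeRing R hiding (zero)

  infixl 6 _⊖_
  _⊖_ : Carrier → Carrier → Carrier
  x ⊖ y = x + (- y)

  two : Carrier
  two = 1# + 1#

  jN : ℕ → Carrier
  jN 0 = two
  jN 1 = k ⊖ 1#
  jN 2 = k * k + 1#
  jN (suc (suc (suc n))) =
    (k ⊖ 1#) * jN (suc (suc n)) + (k ⊖ 1#) * jN (suc n) + k * jN n

  cneg : Carrier
  cneg = (1# ⊖ k) * kinv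

  jNeg : ℕ → Carrier
  jNeg 0 = jN 0
  jNeg 1 = cneg * jN 0 + cneg * jN 1 + kinv * jN 2
  jNeg 2 = cneg * jNeg 1 + cneg * jN 0 + kinv * jN 1
  jNeg (suc (suc (suc n))) =
    cneg * jNeg (suc (suc n)) + cneg * jNeg (suc n) + kinv * jNeg n

  j : ℤ → Carrier
  j (+ n)      = jN n
  j -[1+ n ]   = jNeg (suc n)

  t : ℤ → Carrier
  t m = (k ⊖ 1#) * j (ℤ._+_ m (+ 1)) + k * j m

  Mat : Set c
  Mat = Fin 3 → Fin 3 → Carrier

  _⊗_ : Mat → Mat → Mat
  (A ⊗ B) i l = A i zero * B zero l + A i (suc zero) * B (suc zero) l
                + A i (suc (suc zero)) * B (suc (suc zero)) l

  I3 : Mat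
  I3 zero zero = 1#
  I3 (suc zero) (suc zero) = 1#
  I3 (suc (suc zero)) (suc (suc zero)) = 1#
  I3 _ _ = 0#

  _^^_ : Mat → ℕ → Mat
  A ^^ zero  = I3
  A ^^ suc n = A ⊗ (A ^^ n)

  M : Mat
  M zero zero = k ⊖ 1#
  M zero (suc zero) = k ⊖ 1#
  M zero (suc (suc zero)) = k
  M (suc zero) zero = 1#
  M (suc zero) (suc zero) = 0#
  M (suc zero) (suc (suc zero)) = 0#
  M (suc (suc zero)) zero = 0#
  M (suc (suc zero)) (suc zero) = 1#
  M (suc (suc zero)) (suc (suc zero)) = 0#

  N0 : Mat
  N0 zero zero = k ⊖ 1#
  N0 zero (suc zero) = two * k
  N0 zero (suc (suc zero)) = two * k
  N0 (suc zero) zero = two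
  N0 (suc zero) (suc zero) = 1# ⊖ k
  N0 (suc zero) (suc (suc zero)) = two
  N0 (suc (suc zero)) zero = two * kinv
  N0 (suc (suc zero)) (suc zero) = two * kinv
  N0 (suc (suc zero)) (suc (suc zero)) = - (kinv * (k * k + k ⊖ two))

  RHS : ℤ → Mat
  RHS n zero zero = j (n ℤ.+ (+ 1))
  RHS n zero (suc zero) = t (n ℤ.- (+ 1))
  RHS n zero (suc (suc zero)) = k * j n
  RHS n (suc zero) zero = j n
  RHS n (suc zero) (suc zero) = t (n ℤ.- (+ 2))
  RHS n (suc zero) (suc (suc zero)) = k * j (n ℤ.- (+ 1))
  RHS n (suc (suc zero)) zero = j (n ℤ.- (+ 1))
  RHS n (suc (suc zero)) (suc zero) = t (n ℤ.- (+ 3))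
  RHS n (suc (suc zero)) (suc (suc zero)) = k * j (n ℤ.- (+ 2))

-- The backward extension of j is the recurrence read backwards, so
-- j (z + 3) = (k - 1) j (z + 2) + (k - 1) j (z + 1) + k j z holds on all of ℤ.
-- With row w = (j (w + 1), t (w - 1), k j w), row i of RHS z is row (z - i), and
-- row w · M = row (w + 1): the first entry is the recurrence, the others unfold t.
-- Hence RHS z · M = RHS (z + 1).  Finally N0 = RHS 0, using j (-1) = 2 / k and the
-- recurrence at -2 and -3, so N0 · Mⁿ = RHS 0 · Mⁿ = RHS n.
module Submission where

open import Defs

open import Level using (Level)
open import Algebra.Bundles using (CommutativeRing; RawRing)
open import Data.Nat as ℕ using (ℕ; zero; suc; _∸_; _≤_)
open import Data.Fin using (Fin; zero; suc; toℕ)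
open import Data.Integer as ℤ using (ℤ; +_; -[1+_])
import Data.Integer.Properties as ℤ
open import Data.Integer.Tactic.RingSolver using (solve-∀)
import Data.Nat.Properties as ℕ
open import Data.Product using (_×_; _,_)
open import Data.Maybe using (Maybe; just; nothing)
open import Relation.Nullary using (yes; no)
open import Relation.Binary.PropositionalEquality as ≡ using (_≡_)

-- Tactic.RingSolver would take its coefficients in R itself, where it cannot
-- see that 1# - 1# ≈ 0#; the integers map into every commutative ring.
module IntegerCoefficients {c ℓ : Level} (R : CommutativeRing c ℓ) where
  open CommutativeRing R
  open import Relation.Binary.Reasoning.Setoid setoid
  open import Algebra.Properties.Ring ring using (-‿distribˡ-*; -‿distribʳ-*)
  open import Algebra.Properties.AbelianGroup +-abelianGroup
    using (⁻¹-∙-comm; ε⁻¹≈ε; ⁻¹-involutive; ⁻¹-anti-homo‿-)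
  open import Algebra.Properties.CommutativeSemigroup +-commutativeSemigroup using (interchange)
  open import Algebra.Properties.Semiring.Mult.TCOptimised semiring
    using (×-homo-+; ×1-homo-*) renaming (_×_ to _×′_)
  import Algebra.Solver.Ring.AlmostCommutativeRing as ACR

  -- An integer is a pair (a , b) standing for a − b.  Every operation
  -- returns the normal form with a ≡ 0 or b ≡ 0: the solver closes goals
  -- by comparing normal forms up to definitional equality, so equal
  -- coefficients must be represented identically.
  normal : ℕ → ℕ → ℕ × ℕ
  normal a b = a ∸ b , b ∸ a

  normal-balanced : ∀ a b → a ℕ.+ (b ∸ a) ≡ (a ∸ b) ℕ.+ b
  normal-balanced zero    zero    = ≡.refl
  normal-balanced zero    (suc b) = ≡.refl
  normal-balanced (suc a) zero    = ≡.refl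
  normal-balanced (suc a) (suc b) = ≡.trans (≡.cong suc (normal-balanced a b)) (≡.sym (ℕ.+-suc _ b))

  integers : RawRing _ _
  integers = record
    { Carrier = ℕ × ℕ
    ; _≈_     = _≡_
    ; _+_     = λ { (a , b) (c , d) → normal (a ℕ.+ c) (b ℕ.+ d) }
    ; _*_     = λ { (a , b) (c , d) → normal (a ℕ.* c ℕ.+ b ℕ.* d) (a ℕ.* d ℕ.+ b ℕ.* c) }
    ; -_      = λ { (a , b) → b , a }
    ; 0#      = 0 , 0
    ; 1#      = 1 , 0
    }

  ⌜_⌝ : ℕ → Carrier
  ⌜ n ⌝ = n ×′ 1#

  infix 8 _⊝_
  _⊝_ : ℕ → ℕ → Carrier
  a ⊝ b = ⌜ a ⌝ - ⌜ b ⌝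

  -- (a , 0) denotes ⌜ a ⌝ itself, so that the constants 0# and 1#
  -- appear literally in the solver's output.
  ⟦_⟧ᶜ : ℕ × ℕ → Carrier
  ⟦ a , zero  ⟧ᶜ = ⌜ a ⌝
  ⟦ a , suc b ⟧ᶜ = a ⊝ suc b

  ⟦⟧≈⊝ : ∀ a b → ⟦ a , b ⟧ᶜ ≈ a ⊝ b
  ⟦⟧≈⊝ a zero    = sym (trans (+-congˡ ε⁻¹≈ε) (+-identityʳ _))
  ⟦⟧≈⊝ a (suc b) = refl

  ⊝-cong : ∀ a b c d → a ℕ.+ d ≡ c ℕ.+ b → a ⊝ b ≈ c ⊝ d
  ⊝-cong a b c d eq = begin
    ⌜ a ⌝ - ⌜ b ⌝                          ≈⟨ +-identityʳ _ ⟨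
    (⌜ a ⌝ - ⌜ b ⌝) + 0#                   ≈⟨ +-congˡ (-‿inverseʳ ⌜ d ⌝) ⟨
    (⌜ a ⌝ - ⌜ b ⌝) + (⌜ d ⌝ - ⌜ d ⌝)    ≈⟨ interchange _ _ _ _ ⟩
    (⌜ a ⌝ + ⌜ d ⌝) + (- ⌜ b ⌝ - ⌜ d ⌝) ≈⟨ +-cong a+d≈c+b (+-comm _ _) ⟩
    (⌜ c ⌝ + ⌜ b ⌝) + (- ⌜ d ⌝ - ⌜ b ⌝) ≈⟨ interchange _ _ _ _ ⟩
    (⌜ c ⌝ - ⌜ d ⌝) + (⌜ b ⌝ - ⌜ b ⌝)    ≈⟨ +-congˡ (-‿inverseʳ ⌜ b ⌝) ⟩
    (⌜ c ⌝ - ⌜ d ⌝) + 0#                   ≈⟨ +-identityʳ _ ⟩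
    ⌜ c ⌝ - ⌜ d ⌝                          ∎
    where
    a+d≈c+b : ⌜ a ⌝ + ⌜ d ⌝ ≈ ⌜ c ⌝ + ⌜ b ⌝
    a+d≈c+b = trans (sym (×-homo-+ 1# a d)) (trans (reflexive (≡.cong ⌜_⌝ eq)) (×-homo-+ 1# c b))

  ⟦normal⟧ : ∀ a b → ⟦ normal a b ⟧ᶜ ≈ a ⊝ b
  ⟦normal⟧ a b =
    trans (⟦⟧≈⊝ (a ∸ b) (b ∸ a)) (⊝-cong (a ∸ b) (b ∸ a) a b (≡.sym (normal-balanced a b)))

  ⊝-homo-+ : ∀ a b c d → (a ℕ.+ c) ⊝ (b ℕ.+ d) ≈ a ⊝ b + c ⊝ d
  ⊝-homo-+ a b c d = begin
    ⌜ a ℕ.+ c ⌝ - ⌜ b ℕ.+ d ⌝          ≈⟨ +-cong (×-homo-+ 1# a c) (-‿cong (×-homo-+ 1# b d)) ⟩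
    (⌜ a ⌝ + ⌜ c ⌝) - (⌜ b ⌝ + ⌜ d ⌝) ≈⟨ +-congˡ (⁻¹-∙-comm _ _) ⟨
    (⌜ a ⌝ + ⌜ c ⌝) + (- ⌜ b ⌝ - ⌜ d ⌝) ≈⟨ interchange _ _ _ _ ⟩
    a ⊝ b + c ⊝ d                        ∎

  ⊝-homo-* : ∀ a b c d → (a ℕ.* c ℕ.+ b ℕ.* d) ⊝ (a ℕ.* d ℕ.+ b ℕ.* c) ≈ a ⊝ b * c ⊝ d
  ⊝-homo-* a b c d = begin
    (a ℕ.* c ℕ.+ b ℕ.* d) ⊝ (a ℕ.* d ℕ.+ b ℕ.* c) ≈⟨ ⊝-homo-+ (a ℕ.* c) (a ℕ.* d) (b ℕ.* d) (b ℕ.* c) ⟩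
    (a ℕ.* c) ⊝ (a ℕ.* d) + (b ℕ.* d) ⊝ (b ℕ.* c)
      ≈⟨ +-cong (+-cong (×1-homo-* a c) (-‿cong (×1-homo-* a d)))
                (+-cong (×1-homo-* b d) (-‿cong (×1-homo-* b c))) ⟩
    (A * C - A * D) + (B * D - B * C)  ≈⟨ +-cong (+-congˡ (-‿distribʳ-* A D)) (+-comm _ _) ⟩
    (A * C + A * - D) + (- (B * C) + B * D)
      ≈⟨ +-congˡ (+-cong (-‿distribˡ-* B C) (trans (sym (⁻¹-involutive _)) (-‿cong (-‿distribˡ-* B D)))) ⟩
    (A * C + A * - D) + (- B * C - - B * D)   ≈⟨ +-congˡ (+-congˡ (-‿distribʳ-* (- B) D)) ⟩
    (A * C + A * - D) + (- B * C + - B * - D) ≈⟨ +-cong (distribˡ A C (- D)) (distribˡ (- B) C (- D)) ⟨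
    A * (C - D) + - B * (C - D)               ≈⟨ distribʳ _ A (- B) ⟨
    (A - B) * (C - D)                         ∎
    where
    A = ⌜ a ⌝; B = ⌜ b ⌝; C = ⌜ c ⌝; D = ⌜ d ⌝

  ⟦⟧-morphism : integers ACR.-Raw-AlmostCommutative⟶ ACR.fromCommutativeRing R
  ⟦⟧-morphism = record
    { ⟦_⟧    = ⟦_⟧ᶜ
    ; +-homo = λ { (a , b) (c , d) → trans (⟦normal⟧ (a ℕ.+ c) (b ℕ.+ d))
                     (trans (⊝-homo-+ a b c d) (sym (+-cong (⟦⟧≈⊝ a b) (⟦⟧≈⊝ c d)))) }
    ; *-homo = λ { (a , b) (c , d) → trans (⟦normal⟧ (a ℕ.* c ℕ.+ b ℕ.* d) (a ℕ.* d ℕ.+ b ℕ.* c))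
                     (trans (⊝-homo-* a b c d) (sym (*-cong (⟦⟧≈⊝ a b) (⟦⟧≈⊝ c d)))) }
    ; -‿homo = λ { (a , b) → trans (⟦⟧≈⊝ b a)
                     (trans (sym (⁻¹-anti-homo‿- ⌜ a ⌝ ⌜ b ⌝)) (-‿cong (sym (⟦⟧≈⊝ a b)))) }
    ; 0-homo = refl
    ; 1-homo = refl
    }

  ⟦⟧-≟ : ∀ x y → Maybe (⟦ x ⟧ᶜ ≈ ⟦ y ⟧ᶜ)
  ⟦⟧-≟ (a , b) (c , d) with a ℕ.+ d ℕ.≟ c ℕ.+ b
  ... | yes eq = just (trans (⟦⟧≈⊝ a b) (trans (⊝-cong a b c d eq) (sym (⟦⟧≈⊝ c d))))
  ... | no _   = nothing

  open import Algebra.Solver.Ring integers (ACR.fromCommutativeRing R) ⟦⟧-morphism ⟦⟧-≟ public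

  :zero :one :two : ∀ {n} → Polynomial n
  :zero = con (0 , 0)
  :one  = con (1 , 0)
  :two  = :one :+ :one


i-1+1≡i : ∀ i → i ℤ.- + 1 ℤ.+ + 1 ≡ i
i-1+1≡i = solve-∀

i+1-1≡i : ∀ i → i ℤ.+ + 1 ℤ.- + 1 ≡ i
i+1-1≡i = solve-∀

i-1+2≡i+1 : ∀ i → i ℤ.- + 1 ℤ.+ + 2 ≡ i ℤ.+ + 1
i-1+2≡i+1 = solve-∀

i-1+3≡i+1+1 : ∀ i → i ℤ.- + 1 ℤ.+ + 3 ≡ i ℤ.+ + 1 ℤ.+ + 1
i-1+3≡i+1+1 = solve-∀

i-d+1≡i+1-d : ∀ i d → i ℤ.- d ℤ.+ + 1 ≡ i ℤ.+ + 1 ℤ.- d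
i-d+1≡i+1-d = solve-∀

module Matrices {c ℓ : Level} (R : CommutativeRing c ℓ) (k kinv : CommutativeRing.Carrier R) where
  open CommutativeRing R hiding (zero)
  open JL R k kinv
  open IntegerCoefficients R using (solve; _:=_; _:+_; _:*_; :zero; :one)
  open import Data.Vec.Functional.Relation.Binary.Equality.Setoid setoid public
    using () renaming (_≋_ to _≐_; ≋-setoid to ≐-setoid)
  open import Data.Vec.Functional.Relation.Binary.Equality.Setoid (≐-setoid 3) public
    using (_≋_; ≋-refl; ≋-trans; ≋-reflexive; ≋-setoid)
  open import Relation.Binary.Reasoning.Setoid (≋-setoid 3)

  infixl 7 _⊗ᵥ_
  _⊗ᵥ_ : (Fin 3 → Carrier) → Mat → Fin 3 → Carrier
  (v ⊗ᵥ B) l = v zero * B zero l + v (suc zero) * B (suc zero) l + v (suc (suc zero)) * B (suc (suc zero)) l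

  ⊗ᵥ-cong : ∀ {u v A B} → u ≐ v → A ≋ B → u ⊗ᵥ A ≐ v ⊗ᵥ B
  ⊗ᵥ-cong u≐v A≋B l =
    +-cong (+-cong (*-cong (u≐v zero) (A≋B zero l)) (*-cong (u≐v (suc zero)) (A≋B (suc zero) l)))
           (*-cong (u≐v (suc (suc zero))) (A≋B (suc (suc zero)) l))

  ⊗-cong : ∀ {A A′ B B′} → A ≋ A′ → B ≋ B′ → A ⊗ B ≋ A′ ⊗ B′
  ⊗-cong A≋A′ B≋B′ i = ⊗ᵥ-cong (A≋A′ i) B≋B′

  ⊗-assoc : ∀ A B C → (A ⊗ B) ⊗ C ≋ A ⊗ (B ⊗ C)
  ⊗-assoc A B C i l = solve 15
    (λ a₀ a₁ a₂ b₀₀ b₀₁ b₀₂ b₁₀ b₁₁ b₁₂ b₂₀ b₂₁ b₂₂ c₀ c₁ c₂ →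
      (a₀ :* b₀₀ :+ a₁ :* b₁₀ :+ a₂ :* b₂₀) :* c₀ :+ (a₀ :* b₀₁ :+ a₁ :* b₁₁ :+ a₂ :* b₂₁) :* c₁
        :+ (a₀ :* b₀₂ :+ a₁ :* b₁₂ :+ a₂ :* b₂₂) :* c₂
      := a₀ :* (b₀₀ :* c₀ :+ b₀₁ :* c₁ :+ b₀₂ :* c₂) :+ a₁ :* (b₁₀ :* c₀ :+ b₁₁ :* c₁ :+ b₁₂ :* c₂)
        :+ a₂ :* (b₂₀ :* c₀ :+ b₂₁ :* c₁ :+ b₂₂ :* c₂))
    refl (A i zero) (A i (suc zero)) (A i (suc (suc zero)))
         (B zero zero) (B zero (suc zero)) (B zero (suc (suc zero)))
         (B (suc zero) zero) (B (suc zero) (suc zero)) (B (suc zero) (suc (suc zero)))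
         (B (suc (suc zero)) zero) (B (suc (suc zero)) (suc zero)) (B (suc (suc zero)) (suc (suc zero)))
         (C zero l) (C (suc zero) l) (C (suc (suc zero)) l)

  ⊗-identityʳ : ∀ A → A ⊗ I3 ≋ A
  ⊗-identityʳ A i zero = solve 3 (λ x y z → x :* :one :+ y :* :zero :+ z :* :zero := x)
    refl (A i zero) (A i (suc zero)) (A i (suc (suc zero)))
  ⊗-identityʳ A i (suc zero) = solve 3 (λ x y z → x :* :zero :+ y :* :one :+ z :* :zero := y)
    refl (A i zero) (A i (suc zero)) (A i (suc (suc zero)))
  ⊗-identityʳ A i (suc (suc zero)) = solve 3 (λ x y z → x :* :zero :+ y :* :zero :+ z :* :one := z)
    refl (A i zero) (A i (suc zero)) (A i (suc (suc zero)))

  ⊗-^^-shift : (A : ℤ → Mat) (B : Mat) → (∀ z → A z ⊗ B ≋ A (z ℤ.+ + 1)) →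
               ∀ z n → A z ⊗ (B ^^ n) ≋ A (z ℤ.+ + n)
  ⊗-^^-shift A B step z zero = ≋-trans (⊗-identityʳ (A z)) (≋-reflexive (≡.cong A (≡.sym (ℤ.+-identityʳ z))))
  ⊗-^^-shift A B step z (suc n) = begin
    A z ⊗ (B ⊗ (B ^^ n))     ≈⟨ ⊗-assoc (A z) B (B ^^ n) ⟨
    (A z ⊗ B) ⊗ (B ^^ n)     ≈⟨ ⊗-cong (step z) (≋-refl {x = B ^^ n}) ⟩
    A (z ℤ.+ + 1) ⊗ (B ^^ n) ≈⟨ ⊗-^^-shift A B step (z ℤ.+ + 1) n ⟩
    A (z ℤ.+ + 1 ℤ.+ + n)    ≡⟨ ≡.cong A (ℤ.+-assoc z (+ 1) (+ n)) ⟩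
    A (z ℤ.+ + suc n)        ∎

module JacobsthalLucas {c ℓ : Level} (R : CommutativeRing c ℓ) (k kinv : CommutativeRing.Carrier R)
  (k*kinv≈1 : CommutativeRing._≈_ R (CommutativeRing._*_ R k kinv) (CommutativeRing.1# R)) where
  open CommutativeRing R hiding (zero)
  open import Algebra.Properties.Group +-group using (x≈y⇒x∙y⁻¹≈ε)
  open JL R k kinv
  open Matrices R k kinv
  open IntegerCoefficients R using (solve; _:=_; _:+_; _:*_; _:-_; :-_; :zero; :one; :two)

  -- Together with the solver this proves x ≈ y from known equalities p ≈ q:
  -- the solver checks x ≈ y + c * (p - q) for suitable multipliers c.
  p≈q⇒y+c*[p-q]≈y : ∀ {p q} → p ≈ q → ∀ y c → y + c * (p - q) ≈ y
  p≈q⇒y+c*[p-q]≈y p≈q y c = trans (+-congˡ (trans (*-congˡ (x≈y⇒x∙y⁻¹≈ε p≈q)) (zeroʳ c))) (+-identityʳ y)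

  backward⇒forward : ∀ {x b c w} → w ≈ cneg * b + cneg * c + kinv * x →
                     x ≈ (k ⊖ 1#) * c + (k ⊖ 1#) * b + k * w
  backward⇒forward {x} {b} {c} {w} w≈ = sym (begin
    (k ⊖ 1#) * c + (k ⊖ 1#) * b + k * w
      ≈⟨ +-congˡ (*-congˡ w≈) ⟩
    (k ⊖ 1#) * c + (k ⊖ 1#) * b + k * (cneg * b + cneg * c + kinv * x)
      ≈⟨ solve 5 (λ k u b c x →
           (k :- :one) :* c :+ (k :- :one) :* b :+ k :* ((:one :- k) :* u :* b :+ (:one :- k) :* u :* c :+ u :* x)
           := x :+ ((:one :- k) :* (b :+ c) :+ x) :* (k :* u :- :one)) refl k kinv b c x ⟩
    x + ((1# ⊖ k) * (b + c) + x) * (k * kinv - 1#)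
      ≈⟨ p≈q⇒y+c*[p-q]≈y k*kinv≈1 x _ ⟩
    x ∎)
    where open import Relation.Binary.Reasoning.Setoid setoid

  j-recurrence : ∀ z → j (z ℤ.+ + 3) ≈ (k ⊖ 1#) * j (z ℤ.+ + 2) + (k ⊖ 1#) * j (z ℤ.+ + 1) + k * j z
  -- For z < 0, j z is defined by the backward recurrence, which holds by refl.
  j-recurrence (+ m) rewrite ℕ.+-comm m 3 | ℕ.+-comm m 2 | ℕ.+-comm m 1 = refl
  j-recurrence -[1+ 0 ]                   = backward⇒forward refl
  j-recurrence -[1+ 1 ]                   = backward⇒forward refl
  j-recurrence -[1+ 2 ]                   = backward⇒forward refl
  j-recurrence -[1+ suc (suc (suc n)) ]   = backward⇒forward refl

  j-cong : ∀ {z w} → z ≡ w → j z ≈ j w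
  j-cong z≡w = reflexive (≡.cong j z≡w)

  t-cong : ∀ {z w} → z ≡ w → t z ≈ t w
  t-cong z≡w = reflexive (≡.cong t z≡w)

  row : ℤ → Fin 3 → Carrier
  row w zero             = j (w ℤ.+ + 1)
  row w (suc zero)       = t (w ℤ.- + 1)
  row w (suc (suc zero)) = k * j w

  RHS-row : ∀ z i → RHS z i ≐ row (z ℤ.- + toℕ i)
  RHS-row z zero             zero             = j-cong (≡.cong (ℤ._+ + 1) (≡.sym (ℤ.+-identityʳ z)))
  RHS-row z zero             (suc zero)       = t-cong (≡.cong (ℤ._- + 1) (≡.sym (ℤ.+-identityʳ z)))
  RHS-row z zero             (suc (suc zero)) = *-congˡ (j-cong (≡.sym (ℤ.+-identityʳ z)))
  RHS-row z (suc zero)       zero             = j-cong (≡.sym (i-1+1≡i z))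
  RHS-row z (suc zero)       (suc zero)       = t-cong (≡.sym (ℤ.+-assoc z (ℤ.- + 1) (ℤ.- + 1)))
  RHS-row z (suc zero)       (suc (suc zero)) = refl
  RHS-row z (suc (suc zero)) zero             = j-cong (≡.sym (ℤ.+-assoc z (ℤ.- + 2) (+ 1)))
  RHS-row z (suc (suc zero)) (suc zero)       = t-cong (≡.sym (ℤ.+-assoc z (ℤ.- + 2) (ℤ.- + 1)))
  RHS-row z (suc (suc zero)) (suc (suc zero)) = refl

  row-⊗ᵥ-M : ∀ w → row w ⊗ᵥ M ≐ row (w ℤ.+ + 1)
  row-⊗ᵥ-M w zero = begin
    j (w ℤ.+ + 1) * (k ⊖ 1#) + t (w ℤ.- + 1) * 1# + k * j w * 0#
      ≈⟨ solve 5 (λ k a b c d → a :* (k :- :one) :+ ((k :- :one) :* b :+ k :* c) :* :one :+ k :* d :* :zero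
                              := (k :- :one) :* a :+ (k :- :one) :* b :+ k :* c) refl
                 k (j (w ℤ.+ + 1)) (j (w ℤ.- + 1 ℤ.+ + 1)) (j (w ℤ.- + 1)) (j w) ⟩
    (k ⊖ 1#) * j (w ℤ.+ + 1) + (k ⊖ 1#) * j (w ℤ.- + 1 ℤ.+ + 1) + k * j (w ℤ.- + 1)
      ≈⟨ +-congʳ (+-congʳ (*-congˡ (j-cong (i-1+2≡i+1 w)))) ⟨
    (k ⊖ 1#) * j (w ℤ.- + 1 ℤ.+ + 2) + (k ⊖ 1#) * j (w ℤ.- + 1 ℤ.+ + 1) + k * j (w ℤ.- + 1)
      ≈⟨ j-recurrence (w ℤ.- + 1) ⟨
    j (w ℤ.- + 1 ℤ.+ + 3)
      ≈⟨ j-cong (i-1+3≡i+1+1 w) ⟩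
    j (w ℤ.+ + 1 ℤ.+ + 1) ∎
    where open import Relation.Binary.Reasoning.Setoid setoid
  row-⊗ᵥ-M w (suc zero) = begin
    j (w ℤ.+ + 1) * (k ⊖ 1#) + t (w ℤ.- + 1) * 0# + k * j w * 1#
      ≈⟨ solve 4 (λ k a t b → a :* (k :- :one) :+ t :* :zero :+ k :* b :* :one
                              := (k :- :one) :* a :+ k :* b) refl k (j (w ℤ.+ + 1)) (t (w ℤ.- + 1)) (j w) ⟩
    t w
      ≈⟨ t-cong (i+1-1≡i w) ⟨
    t (w ℤ.+ + 1 ℤ.- + 1) ∎
    where open import Relation.Binary.Reasoning.Setoid setoid
  row-⊗ᵥ-M w (suc (suc zero)) =
    solve 4 (λ k a t b → a :* k :+ t :* :zero :+ k :* b :* :zero := k :* a)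
      refl k (j (w ℤ.+ + 1)) (t (w ℤ.- + 1)) (j w)

  RHS-⊗-M : ∀ z → RHS z ⊗ M ≋ RHS (z ℤ.+ + 1)
  RHS-⊗-M z i = begin
    RHS z i ⊗ᵥ M                       ≈⟨ ⊗ᵥ-cong (RHS-row z i) (≋-refl {x = M}) ⟩
    row (z ℤ.- d) ⊗ᵥ M                 ≈⟨ row-⊗ᵥ-M (z ℤ.- d) ⟩
    row (z ℤ.- d ℤ.+ + 1)              ≡⟨ ≡.cong row (i-d+1≡i+1-d z d) ⟩
    row (z ℤ.+ + 1 ℤ.- d)              ≈⟨ RHS-row (z ℤ.+ + 1) i ⟨
    RHS (z ℤ.+ + 1) i                  ∎
    where
    open import Relation.Binary.Reasoning.Setoid (≐-setoid 3)
    d = + toℕ i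

  j-1≈2/k : j -[1+ 0 ] ≈ two * kinv
  j-1≈2/k = solve 2 (λ k u → (:one :- k) :* u :* :two :+ (:one :- k) :* u :* (k :- :one) :+ u :* (k :* k :+ :one)
                             := :two :* u) refl k kinv

  k*j-1≈2 : k * j -[1+ 0 ] ≈ two
  k*j-1≈2 = trans (*-congˡ j-1≈2/k)
    (trans (solve 2 (λ k u → k :* (:two :* u) := :two :+ :two :* (k :* u :- :one)) refl k kinv)
           (p≈q⇒y+c*[p-q]≈y k*kinv≈1 two two))

  N0≋RHS0 : N0 ≋ RHS (+ 0)
  N0≋RHS0 zero zero = refl
  N0≋RHS0 zero (suc zero) =
    trans (solve 2 (λ k a → :two :* k := (k :- :one) :* :two :+ k :* a :+ (:- :one) :* (k :* a :- :two))
                   refl k (j -[1+ 0 ]))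
          (p≈q⇒y+c*[p-q]≈y k*j-1≈2 _ _)
  N0≋RHS0 zero (suc (suc zero)) = *-comm two k
  N0≋RHS0 (suc zero) zero = refl
  N0≋RHS0 (suc zero) (suc zero) =
    trans (solve 3 (λ k a b → :one :- k := (k :- :one) :* a :+ k :* b
                               :+ :one :* ((k :- :one) :- ((k :- :one) :* :two :+ (k :- :one) :* a :+ k :* b)))
                   refl k (j -[1+ 0 ]) (j -[1+ 1 ]))
          (p≈q⇒y+c*[p-q]≈y (j-recurrence -[1+ 1 ]) _ _)
  N0≋RHS0 (suc zero) (suc (suc zero)) = sym k*j-1≈2
  N0≋RHS0 (suc (suc zero)) zero = sym j-1≈2/k
  N0≋RHS0 (suc (suc zero)) (suc zero) =
    trans (sym j-1≈2/k)
      (trans (solve 4 (λ k a b c → a := (k :- :one) :* b :+ k :* c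
                         :+ :one :* (:two :- ((k :- :one) :* a :+ (k :- :one) :* b :+ k :* c))
                         :+ :one :* (k :* a :- :two)) refl k (j -[1+ 0 ]) (j -[1+ 1 ]) (j -[1+ 2 ]))
        (trans (p≈q⇒y+c*[p-q]≈y k*j-1≈2 _ _) (p≈q⇒y+c*[p-q]≈y (j-recurrence -[1+ 2 ]) _ _)))
  N0≋RHS0 (suc (suc zero)) (suc (suc zero)) =
    trans (solve 4 (λ k u a b → :- (u :* (k :* k :+ k :- :two)) := k :* b
                       :+ :one :* ((k :- :one) :- ((k :- :one) :* :two :+ (k :- :one) :* a :+ k :* b))
                       :+ (k :- :one) :* (a :- :two :* u)
                       :+ (:one :- k) :* (k :* u :- :one)) refl k kinv (j -[1+ 0 ]) (j -[1+ 1 ]))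
      (trans (p≈q⇒y+c*[p-q]≈y k*kinv≈1 _ _)
        (trans (p≈q⇒y+c*[p-q]≈y j-1≈2/k _ _) (p≈q⇒y+c*[p-q]≈y (j-recurrence -[1+ 1 ]) _ _)))

  N0⊗M^^n≋RHS : ∀ n → N0 ⊗ (M ^^ n) ≋ RHS (+ n)
  N0⊗M^^n≋RHS n = ≋-trans (⊗-cong N0≋RHS0 (≋-refl {x = M ^^ n})) (⊗-^^-shift RHS M RHS-⊗-M (+ 0) n)

proposition1p6 : ∀ {c ℓ : Level} (R : CommutativeRing c ℓ)
    (k kinv : CommutativeRing.Carrier R) →
    CommutativeRing._≈_ R (CommutativeRing._*_ R k kinv) (CommutativeRing.1# R) →
    (n : ℕ) → 1 ≤ n → (a b : Fin 3) →
    CommutativeRing._≈_ R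
      (JL._⊗_ R k kinv (JL.N0 R k kinv) (JL._^^_ R k kinv (JL.M R k kinv) n) a b)
      (JL.RHS R k kinv (+ n) a b)
-- N0 is the n = 0 instance of RHS.
proposition1p6 R k kinv k*kinv≈1 n _ = JacobsthalLucas.N0⊗M^^n≋RHS R k kinv k*kinv≈1 n
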